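{- For every integer $n\ge 7$, $\beta(P(n,3))=n$ if $n$ is even and $\beta(P(n,3))=n+2$ if $n$ is odd.
   Context: $P(n,k)$ is the generalized Petersen graph with vertices $u_1,\dots,u_n,v_1,\dots,v_n$ and edges $u_iu_{i+1}$, $u_iv_i$, $v_iv_{i+k}$ (subscripts modulo $n$), defined for $n>2k$. $\beta(G)$ denotes the size of a minimum vertex cover of $G$. -}

module Defs where

open import Data.Nat using (ℕ; zero; suc; _+_; _%_; NonZero; _≤_; _*_)
open import Data.Fin using (Fin; toℕ)
open import Data.Sum using (_⊎_; inj₁; inj₂)
open import Data.Bool using (Bool; true; false; T; T?)
open import Data.List using (List; length; filter; allFin)
open import Data.Product using (_×_; Σ; ∃)
open import Relation.Binary.PropositionalEquality using (_≡_)
open import Relation.Nullary using (Dec)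

-- Vertex set of P(n,k): inj₁ i = u_i, inj₂ i = v_i  (i ∈ {0,…,n-1}).
Vertex : ℕ → Set
Vertex n = Fin n ⊎ Fin n

-- a ≡ b (mod n), for a ≤ b:  b = a + q·n for some q.  (Used with a = toℕ j < n,
-- so it says j is the residue of b modulo n.)
CongMod : ℕ → ℕ → ℕ → Set
CongMod n a b = Σ ℕ λ q → b ≡ a + q * n

-- Edge x y is the (directed) presentation of an edge; the undirected edge set
-- is its symmetric closure, which is what matters for vertex covers below.
data Edge (n k : ℕ) : Vertex n → Vertex n → Set where
  outer : (i j : Fin n) → CongMod n (toℕ j) (toℕ i + 1) → Edge n k (inj₁ i) (inj₁ j)
  spoke : (i : Fin n) → Edge n k (inj₁ i) (inj₂ i)
  inner : (i j : Fin n) → CongMod n (toℕ j) (toℕ i + k) → Edge n k (inj₂ i) (inj₂ j)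

VSubset : ℕ → Set
VSubset n = Vertex n → Bool

size : {n : ℕ} → VSubset n → ℕ
size {n} S = length (filter (λ i → T? (S (inj₁ i))) (allFin n))
           + length (filter (λ i → T? (S (inj₂ i))) (allFin n))

IsVertexCover : (n k : ℕ) → VSubset n → Set
IsVertexCover n k S = ∀ x y → Edge n k x y → T (S x) ⊎ T (S y)

VertexCoverNumber : (n k : ℕ) → ℕ → Set
VertexCoverNumber n k m =
  (Σ (VSubset n) λ S → IsVertexCover n k S × size S ≡ m)
  × (∀ S → IsVertexCover n k S → m ≤ size S)

-- The n spokes u_i v_i form a perfect matching, so every vertex cover has at
-- least n vertices; call an index i "doubled" for a cover S when both u_i and
-- v_i lie in S.  Each doubled index adds one to this bound.
--
-- Even n: the alternating set {u_i | i even} ∪ {v_i | i odd} covers P(n,k) for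
-- every odd k, since outer and inner edges join indices of opposite parity.
--
-- Odd n = 7 + 2j: the set {u_i | i even} ∪ {v_i | i odd or i ≤ 2} is a cover of
-- size n + 2.  For the lower bound we show that any window of n − 1
-- consecutive indices contains a doubled index (module Window: along such a
-- window the u-membership is forced to be 2-periodic, which clashes with the
-- inner edges wrapping around the odd cycle).  Applied once from index 0 and
-- once from the first doubled index found, this gives two distinct doubled
-- indices, hence at least n + 2 vertices.
module Submission where

open import Defs
open import Data.Nat using (ℕ; zero; suc; _≤_; _<_; _+_; _*_; _%_; _/_; NonZero; z≤n; s≤s)
open import Data.Nat.Properties
  using (+-suc; +-identityʳ; +-comm; +-assoc; +-mono-≤; +-monoʳ-≤; +-monoˡ-<; *-monoʳ-≤; *-suc;
         +-cancelʳ-≡; +-cancelˡ-<; <-irrefl; ≤-refl; ≤-trans; m≤m+n; m+n≤o⇒n≤o; n≤1+n; n<1⇒n≡0;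
         module ≤-Reasoning)
open import Data.Nat.DivMod using (_mod_; m≡m%n+[m/n]*n; %-distribˡ-+; m%n%n≡m%n; [m+n]%n≡m%n; m%n<n)
open import Data.Nat.Tactic.RingSolver using (solve-∀)
open import Data.Fin using (Fin; toℕ; _≟_) renaming (zero to fzero; suc to fsuc)
open import Data.Fin.Properties using (toℕ-fromℕ<; toℕ-injective; toℕ<n; any?)
open import Data.Bool using (Bool; true; false; T; not)
open import Data.List using (length; filter; tabulate)
open import Data.Product using (_×_; Σ; ∃-syntax; _,_)
open import Data.Sum using (_⊎_; inj₁; inj₂)
open import Data.Empty using (⊥; ⊥-elim)
open import Data.Unit using (tt)
open import Function using (_∘_)
open import Relation.Binary.PropositionalEquality
open import Relation.Nullary using (¬_; yes; no)
open import Relation.Unary using (Decidable)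
open import Relation.Nullary.Decidable using (_×-dec_; ¬?)
open import Relation.Nullary.Decidable.Core using (T?)

resolveˡ : {A B : Set} → A ⊎ B → ¬ B → A
resolveˡ (inj₁ a) _  = a
resolveˡ (inj₂ b) ¬b = ⊥-elim (¬b b)

resolveʳ : {A B : Set} → A ⊎ B → ¬ A → B
resolveʳ (inj₁ a) ¬a = ⊥-elim (¬a a)
resolveʳ (inj₂ b) _  = b

T⇒≡true : ∀ {b} → T b → b ≡ true
T⇒≡true {true} _ = refl

¬T⇒≡false : ∀ {b} → ¬ T b → b ≡ false
¬T⇒≡false {false} _ = refl
¬T⇒≡false {true} ¬t = ⊥-elim (¬t tt)

one-of : ∀ a b → b ≡ not a → T a ⊎ T b
one-of true  _ _    = inj₁ tt
one-of false _ refl = inj₂ tt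

one-of-not : ∀ a b → b ≡ not a → T (not a) ⊎ T (not b)
one-of-not false _ _    = inj₁ tt
one-of-not true  _ refl = inj₂ tt

isEven : ℕ → Bool
isEven zero          = true
isEven (suc zero)    = false
isEven (suc (suc n)) = isEven n

isEven-suc : ∀ n → isEven (suc n) ≡ not (isEven n)
isEven-suc zero          = refl
isEven-suc (suc zero)    = refl
isEven-suc (suc (suc n)) = isEven-suc n

isEven-+-even : ∀ {m} n → isEven m ≡ true → isEven (n + m) ≡ isEven n
isEven-+-even     zero    m-even = m-even
isEven-+-even {m} (suc n) m-even = begin
  isEven (suc (n + m))   ≡⟨ isEven-suc (n + m) ⟩
  not (isEven (n + m))   ≡⟨ cong not (isEven-+-even n m-even) ⟩
  not (isEven n)         ≡⟨ sym (isEven-suc n) ⟩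
  isEven (suc n)         ∎
  where open ≡-Reasoning

isEven-+-odd : ∀ {m} n → isEven m ≡ false → isEven (n + m) ≡ not (isEven n)
isEven-+-odd     zero    m-odd = m-odd
isEven-+-odd {m} (suc n) m-odd = begin
  isEven (suc (n + m))   ≡⟨ isEven-suc (n + m) ⟩
  not (isEven (n + m))   ≡⟨ cong not (isEven-+-odd n m-odd) ⟩
  not (not (isEven n))   ≡⟨ cong not (sym (isEven-suc n)) ⟩
  not (isEven (suc n))   ∎
  where open ≡-Reasoning

isEven-*-even : ∀ {n} q → isEven n ≡ true → isEven (q * n) ≡ true
isEven-*-even zero    _      = refl
isEven-*-even {n} (suc q) n-even =
  trans (isEven-+-even n (isEven-*-even q n-even)) n-even

isEven-double : ∀ m → isEven (2 * m) ≡ true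
isEven-double m = subst (λ x → isEven x ≡ true) (cong (m +_) (sym (+-identityʳ m))) (even-sum m)
  where
    even-sum : ∀ m → isEven (m + m) ≡ true
    even-sum zero    = refl
    even-sum (suc m) = trans (cong (isEven ∘ suc) (+-suc m m)) (even-sum m)

indicator : Bool → ℕ
indicator true  = 1
indicator false = 0

pairCount : ∀ n → (Fin n → Bool) → (Fin n → Bool) → ℕ
pairCount zero    a b = 0
pairCount (suc n) a b = (indicator (a fzero) + indicator (b fzero)) + pairCount n (a ∘ fsuc) (b ∘ fsuc)

filters-pairCount : ∀ {A : Set} n (a b : A → Bool) (g : Fin n → A) →
  length (filter (λ i → T? (a i)) (tabulate g)) + length (filter (λ i → T? (b i)) (tabulate g))
    ≡ pairCount n (a ∘ g) (b ∘ g)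
filters-pairCount zero    a b g = refl
filters-pairCount (suc n) a b g with a (g fzero) | b (g fzero) | filters-pairCount n a b (g ∘ fsuc)
... | true  | true  | rest = cong suc (trans (+-suc _ _) (cong suc rest))
... | true  | false | rest = cong suc rest
... | false | true  | rest = trans (+-suc _ _) (cong suc rest)
... | false | false | rest = rest

size-pairCount : ∀ {n} (S : VSubset n) → size S ≡ pairCount n (S ∘ inj₁) (S ∘ inj₂)
size-pairCount {n} S = filters-pairCount n (S ∘ inj₁) (S ∘ inj₂) (λ i → i)

pairCount-complement : ∀ n (a : Fin n → Bool) → pairCount n a (not ∘ a) ≡ n
pairCount-complement zero    a = refl
pairCount-complement (suc n) a with a fzero
... | true  = cong suc (pairCount-complement n (a ∘ fsuc))
... | false = cong suc (pairCount-complement n (a ∘ fsuc))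

Covers : ∀ {n} → (Fin n → Bool) → (Fin n → Bool) → Set
Covers {n} a b = ∀ i → T (a i) ⊎ T (b i)

Doubled : ∀ {n} → (Fin n → Bool) → (Fin n → Bool) → Fin n → Set
Doubled a b i = T (a i) × T (b i)

covered-spoke : ∀ x y → T x ⊎ T y → 1 ≤ indicator x + indicator y
covered-spoke true  _     _        = s≤s z≤n
covered-spoke false true  _        = s≤s z≤n
covered-spoke false false (inj₁ ())
covered-spoke false false (inj₂ ())

doubled-spoke : ∀ x y → T x → T y → 2 ≤ indicator x + indicator y
doubled-spoke true true _ _ = s≤s (s≤s z≤n)

pairCount-covering : ∀ n a b → Covers {n} a b → n ≤ pairCount n a b
pairCount-covering zero    a b c = z≤n
pairCount-covering (suc n) a b c =
  +-mono-≤ (covered-spoke _ _ (c fzero)) (pairCount-covering n (a ∘ fsuc) (b ∘ fsuc) (c ∘ fsuc))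

pairCount-one-doubled : ∀ n a b → Covers {n} a b → ∀ p → Doubled a b p → suc n ≤ pairCount n a b
pairCount-one-doubled (suc n) a b c fzero (ap , bp) =
  +-mono-≤ (doubled-spoke _ _ ap bp) (pairCount-covering n (a ∘ fsuc) (b ∘ fsuc) (c ∘ fsuc))
pairCount-one-doubled (suc n) a b c (fsuc p) dp =
  +-mono-≤ (covered-spoke _ _ (c fzero)) (pairCount-one-doubled n (a ∘ fsuc) (b ∘ fsuc) (c ∘ fsuc) p dp)

pairCount-two-doubled : ∀ n a b → Covers {n} a b → ∀ p q → Doubled a b p → Doubled a b q → p ≢ q →
  2 + n ≤ pairCount n a b
pairCount-two-doubled (suc n) a b c fzero    fzero    _ _ p≢q = ⊥-elim (p≢q refl)
pairCount-two-doubled (suc n) a b c fzero    (fsuc q) (ap , bp) dq _ =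
  +-mono-≤ (doubled-spoke _ _ ap bp) (pairCount-one-doubled n (a ∘ fsuc) (b ∘ fsuc) (c ∘ fsuc) q dq)
pairCount-two-doubled (suc n) a b c (fsuc p) fzero    dp (aq , bq) _ =
  +-mono-≤ (doubled-spoke _ _ aq bq) (pairCount-one-doubled n (a ∘ fsuc) (b ∘ fsuc) (c ∘ fsuc) p dp)
pairCount-two-doubled (suc n) a b c (fsuc p) (fsuc q) dp dq p≢q =
  +-mono-≤ (covered-spoke _ _ (c fzero))
           (pairCount-two-doubled n (a ∘ fsuc) (b ∘ fsuc) (c ∘ fsuc) p q dp dq (p≢q ∘ cong fsuc))

spokes-covered : ∀ {n k} (S : VSubset n) → IsVertexCover n k S → Covers (S ∘ inj₁) (S ∘ inj₂)
spokes-covered S cover i = cover _ _ (spoke i)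

matching-bound : ∀ {n k} (S : VSubset n) → IsVertexCover n k S → n ≤ size S
matching-bound {n} S cover =
  subst (n ≤_) (sym (size-pairCount S)) (pairCount-covering n _ _ (spokes-covered S cover))

residue-parity : ∀ {n x y s} → isEven n ≡ true → isEven s ≡ false →
  CongMod n y (x + s) → isEven y ≡ not (isEven x)
residue-parity {n} {x} {y} {s} n-even s-odd (q , x+s≡y+qn) = begin
  isEven y            ≡⟨ sym (isEven-+-even y (isEven-*-even q n-even)) ⟩
  isEven (y + q * n)  ≡⟨ cong isEven (sym x+s≡y+qn) ⟩
  isEven (x + s)      ≡⟨ isEven-+-odd x s-odd ⟩
  not (isEven x)      ∎
  where open ≡-Reasoning

alternating : ∀ {n} → VSubset n
alternating (inj₁ i) = isEven (toℕ i)
alternating (inj₂ i) = not (isEven (toℕ i))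

alternating-cover : ∀ {n k} → isEven n ≡ true → isEven k ≡ false → IsVertexCover n k alternating
alternating-cover n-even k-odd _ _ (outer i j i~j) = one-of _ _ (residue-parity {s = 1} n-even refl i~j)
alternating-cover n-even k-odd _ _ (spoke i)       = one-of _ _ refl
alternating-cover {k = k} n-even k-odd _ _ (inner i j i~j) =
  one-of-not _ _ (residue-parity {s = k} n-even k-odd i~j)

alternating-size : ∀ n → size (alternating {n}) ≡ n
alternating-size n = trans (size-pairCount (alternating {n})) (pairCount-complement n _)

vertexCoverNumber-even : ∀ n k → isEven n ≡ true → isEven k ≡ false → VertexCoverNumber n k n
vertexCoverNumber-even n k n-even k-odd =
  (alternating , alternating-cover n-even k-odd , alternating-size n) , matching-bound {n} {k}

[m%n+k]%n≡[m+k]%n : ∀ m k n .{{_ : NonZero n}} → (m % n + k) % n ≡ (m + k) % n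
[m%n+k]%n≡[m+k]%n m k n = begin
  (m % n + k) % n          ≡⟨ %-distribˡ-+ (m % n) k n ⟩
  (m % n % n + k % n) % n  ≡⟨ cong (λ r → (r + k % n) % n) (m%n%n≡m%n m n) ⟩
  (m % n + k % n) % n      ≡⟨ sym (%-distribˡ-+ m k n) ⟩
  (m + k) % n              ∎
  where open ≡-Reasoning

module Residues (n : ℕ) .{{_ : NonZero n}} where

  idx : ℕ → Fin n
  idx s = s mod n

  toℕ-idx : ∀ s → toℕ (idx s) ≡ s % n
  toℕ-idx s = toℕ-fromℕ< (m%n<n s n)

  idx-step : ∀ k s → CongMod n (toℕ (idx (k + s))) (toℕ (idx s) + k)
  idx-step k s = r / n , (begin
    toℕ (idx s) + k          ≡⟨ cong (_+ k) (toℕ-idx s) ⟩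
    r                        ≡⟨ m≡m%n+[m/n]*n r n ⟩
    r % n + (r / n) * n      ≡⟨ cong (_+ (r / n) * n) r%n≡toℕ ⟩
    toℕ (idx (k + s)) + (r / n) * n ∎)
    where
      open ≡-Reasoning
      r : ℕ
      r = s % n + k
      r%n≡toℕ : r % n ≡ toℕ (idx (k + s))
      r%n≡toℕ = trans ([m%n+k]%n≡[m+k]%n s k n)
                      (trans (cong (_% n) (+-comm s k)) (sym (toℕ-idx (k + s))))

  idx-periodic : ∀ k s → idx (k + (n + s)) ≡ idx (k + s)
  idx-periodic k s = toℕ-injective (begin
    toℕ (idx (k + (n + s)))  ≡⟨ toℕ-idx _ ⟩
    (k + (n + s)) % n        ≡⟨ cong (λ m → (k + m) % n) (+-comm n s) ⟩
    (k + (s + n)) % n        ≡⟨ cong (_% n) (sym (+-assoc k s n)) ⟩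
    (k + s + n) % n          ≡⟨ [m+n]%n≡m%n (k + s) n ⟩
    (k + s) % n              ≡⟨ sym (toℕ-idx _) ⟩
    toℕ (idx (k + s))        ∎)
    where open ≡-Reasoning

  idx-moves : ∀ (p : Fin n) t → 1 ≤ t → t < n → idx (t + toℕ p) ≢ p
  idx-moves p t 1≤t t<n same = not-multiple ((t + P) / n) t≡qn
    where
      P : ℕ
      P = toℕ p
      residue : (t + P) % n ≡ P
      residue = trans (sym (toℕ-idx _)) (cong toℕ same)
      t+P≡qn+P : t + P ≡ (t + P) / n * n + P
      t+P≡qn+P = begin
        t + P                          ≡⟨ m≡m%n+[m/n]*n (t + P) n ⟩
        (t + P) % n + (t + P) / n * n  ≡⟨ cong (_+ (t + P) / n * n) residue ⟩
        P + (t + P) / n * n            ≡⟨ +-comm P _ ⟩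
        (t + P) / n * n + P            ∎
        where open ≡-Reasoning
      t≡qn : t ≡ (t + P) / n * n
      t≡qn = +-cancelʳ-≡ P t _ t+P≡qn+P
      not-multiple : ∀ q → t ≢ q * n
      not-multiple zero    refl = <-irrefl refl 1≤t
      not-multiple (suc q) refl = <-irrefl refl (≤-trans t<n (m≤m+n n (q * n)))

-- Read f t and g t as "u and v at position t are in
-- the cover", for positions 1 … 6 + 2j (a window of n − 1 indices of the
-- (7+2j)-cycle), and suppose no position of the window is doubled.  Outer edges
-- forbid two consecutive missing u's and inner edges (with v_t ∉ S whenever
-- u_t ∈ S) forbid u's at distance 3; this forces f(t+2) = f(t), and then the
-- two inner edges jumping over the window's end give a contradiction.
module Window (j : ℕ) (f g : ℕ → Bool)
  (outer : ∀ t → T (f t) ⊎ T (f (suc t)))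
  (inner : ∀ t → T (g t) ⊎ T (g (3 + t)))
  (single : ∀ t → 1 ≤ t → t ≤ 6 + 2 * j → T (f t) → ¬ T (g t))
  (period₁ : g (8 + 2 * j) ≡ g 1)
  (period₂ : g (9 + 2 * j) ≡ g 2)
  where

  W : ℕ
  W = 6 + 2 * j

  -- u_t ∈ S puts v_t outside S, so the inner edge forces v_{t+3} ∈ S.
  inner-after : ∀ t → 1 ≤ t → t ≤ W → T (f t) → T (g (3 + t))
  inner-after t 1≤t t≤W ft = resolveʳ (inner t) (single t 1≤t t≤W ft)

  no-gap-three : ∀ t → 1 ≤ t → 3 + t ≤ W → T (f t) → ¬ T (f (3 + t))
  no-gap-three t 1≤t 3+t≤W ft f₃ =
    single (3 + t) (s≤s z≤n) 3+t≤W f₃ (inner-after t 1≤t (m+n≤o⇒n≤o 3 3+t≤W) ft)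

  two-periodic : ∀ t → 1 ≤ t → 4 + t ≤ W → f (3 + t) ≡ f (1 + t)
  two-periodic t 1≤t 4+t≤W with f (1 + t) in e
  ... | true  = T⇒≡true (resolveˡ (outer (3 + t)) (no-gap-three (1 + t) (s≤s z≤n) 4+t≤W f₁))
    where f₁ : T (f (1 + t))
          f₁ = subst T (sym e) tt
  ... | false = ¬T⇒≡false (no-gap-three t 1≤t (≤-trans (n≤1+n _) 4+t≤W) f₀)
    where f₀ : T (f t)
          f₀ = resolveˡ (outer t) (λ f₁ → subst T e f₁)

  odd-positions : ∀ k → k ≤ j → f (5 + 2 * k) ≡ f 5
  odd-positions zero    _     = refl
  odd-positions (suc k) 1+k≤j = begin
    f (5 + 2 * suc k)   ≡⟨ cong (λ x → f (5 + x)) (*-suc 2 k) ⟩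
    f (7 + 2 * k)       ≡⟨ two-periodic (4 + 2 * k) (s≤s z≤n) bound ⟩
    f (5 + 2 * k)       ≡⟨ odd-positions k (≤-trans (n≤1+n k) 1+k≤j) ⟩
    f 5                 ∎
    where
      open ≡-Reasoning
      bound : 8 + 2 * k ≤ W
      bound = subst (_≤ W) (cong (6 +_) (*-suc 2 k)) (+-monoʳ-≤ 6 (*-monoʳ-≤ 2 1+k≤j))

  -- If u_2 ∈ S, then u_5 ∉ S, so u_{5+2j} ∉ S and u_{6+2j} ∈ S, whose inner
  -- edge wraps to v_2; if u_2 ∉ S, then u_1, u_3, u_5, u_{5+2j} ∈ S, whose
  -- inner edge wraps to v_1.  Either way some position is doubled.
  impossible : ⊥
  impossible with f 2 in e
  ... | true  = single 2 (s≤s z≤n) (s≤s (s≤s z≤n)) f₂ g₂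
    where
      f₂ : T (f 2)
      f₂ = subst T (sym e) tt
      ¬f-end : ¬ T (f (5 + 2 * j))
      ¬f-end = no-gap-three 2 (s≤s z≤n) (s≤s (s≤s (s≤s (s≤s (s≤s z≤n))))) f₂
               ∘ subst T (odd-positions j ≤-refl)
      g₂ : T (g 2)
      g₂ = subst T period₂
             (inner-after (6 + 2 * j) (s≤s z≤n) ≤-refl (resolveʳ (outer (5 + 2 * j)) ¬f-end))
  ... | false = single 1 (s≤s z≤n) (s≤s z≤n) f₁ g₁
    where
      ¬f₂ : ¬ T (f 2)
      ¬f₂ = subst T e
      f₁ : T (f 1)
      f₁ = resolveˡ (outer 1) ¬f₂
      f₅ : T (f 5)
      f₅ = subst T (sym (two-periodic 2 (s≤s z≤n) (+-monoʳ-≤ 6 z≤n))) (resolveʳ (outer 2) ¬f₂)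
      g₁ : T (g 1)
      g₁ = subst T period₁ (inner-after (5 + 2 * j) (s≤s z≤n) (n≤1+n _)
                              (subst T (sym (odd-positions j ≤-refl)) f₅))

module OddLowerBound (j : ℕ) (S : VSubset (7 + 2 * j)) (cover : IsVertexCover (7 + 2 * j) 3 S) where

  N : ℕ
  N = 7 + 2 * j

  open Residues N

  u v : Fin N → Bool
  u = S ∘ inj₁
  v = S ∘ inj₂

  window-has-doubled : ∀ P → ¬ (∀ t → 1 ≤ t → t ≤ 6 + 2 * j → ¬ Doubled u v (idx (t + P)))
  window-has-doubled P none =
    Window.impossible j f g
      (λ t → cover _ _ (outer _ _ (idx-step 1 (t + P))))
      (λ t → cover _ _ (inner _ _ (idx-step 3 (t + P))))
      (λ t 1≤t t≤W ft gt → none t 1≤t t≤W (ft , gt))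
      (cong v (idx-periodic 1 P))
      (cong v (idx-periodic 2 P))
    where
      f g : ℕ → Bool
      f t = u (idx (t + P))
      g t = v (idx (t + P))

  doubled? : Decidable (Doubled u v)
  doubled? i = T? (u i) ×-dec T? (v i)

  -- Hence there are two distinct doubled indices: one in the window after 0,
  -- and another in the window after that one.
  two-doubled : Σ (Fin N) λ p → Σ (Fin N) λ q → Doubled u v p × Doubled u v q × p ≢ q
  two-doubled with any? doubled?
  ... | no none = ⊥-elim (window-has-doubled 0 (λ t _ _ d → none (_ , d)))
  ... | yes (p , dp) with any? (λ q → doubled? q ×-dec ¬? (q ≟ p))
  ...   | yes (q , dq , q≢p) = p , q , dp , dq , q≢p ∘ sym
  ...   | no none = ⊥-elim (window-has-doubled (toℕ p)
                      (λ t 1≤t t≤W d → none (_ , d , idx-moves p t 1≤t (s≤s t≤W))))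

  lower-bound : N + 2 ≤ size S
  lower-bound with two-doubled
  ... | p , q , dp , dq , p≢q =
    subst₂ _≤_ (+-comm 2 N) (sym (size-pairCount S))
      (pairCount-two-doubled N u v (spokes-covered S cover) p q dp dq p≢q)

wrapped-target : ∀ {n} x y k q → x < n → x + k ≡ y + suc q * n → y < k
wrapped-target {n} x y k q x<n x+k≡y+n+qn = +-cancelˡ-< n y k (begin-strict
  n + y             ≡⟨ +-comm n y ⟩
  y + n             ≤⟨ +-monoʳ-≤ y (m≤m+n n (q * n)) ⟩
  y + suc q * n     ≡⟨ sym x+k≡y+n+qn ⟩
  x + k             <⟨ +-monoˡ-< k x<n ⟩
  n + k             ∎)
  where open ≤-Reasoning

unwrapped-parity : ∀ x y k → x + k ≡ y + 0 → isEven y ≡ isEven (x + k)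
unwrapped-parity x y k x+k≡y+0 = cong isEven (trans (sym (+-identityʳ y)) (sym x+k≡y+0))

oddInner : ℕ → Bool
oddInner i@(suc (suc (suc _))) = not (isEven i)
oddInner _                     = true

oddInner-odd : ∀ i → isEven i ≡ false → T (oddInner i)
oddInner-odd zero                ()
oddInner-odd (suc zero)          _    = tt
oddInner-odd (suc (suc zero))    ()
oddInner-odd (suc (suc (suc i))) odd rewrite odd = tt

oddInner-small : ∀ i → i < 3 → T (oddInner i)
oddInner-small zero             _ = tt
oddInner-small (suc zero)       _ = tt
oddInner-small (suc (suc zero)) _ = tt
oddInner-small (suc (suc (suc i))) (s≤s (s≤s (s≤s ())))

oddCover : ∀ {n} → VSubset n
oddCover (inj₁ i) = isEven (toℕ i)
oddCover (inj₂ i) = oddInner (toℕ i)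

-- Non-wrapping outer and inner edges join indices of opposite parity; an outer
-- edge wrapping around ends at u_0, an inner one at v_0, v_1 or v_2.
oddCover-cover : ∀ n → IsVertexCover n 3 oddCover
oddCover-cover n _ _ (outer i i′ (zero , e)) =
  one-of _ _ (trans (unwrapped-parity (toℕ i) (toℕ i′) 1 e) (isEven-+-odd {1} (toℕ i) refl))
oddCover-cover n _ _ (outer i i′ (suc q , e)) =
  inj₂ (subst (T ∘ isEven) (sym (n<1⇒n≡0 (wrapped-target (toℕ i) (toℕ i′) 1 q (toℕ<n i) e))) tt)
oddCover-cover n _ _ (spoke i) with isEven (toℕ i) in e
... | true  = inj₁ tt
... | false = inj₂ (oddInner-odd (toℕ i) e)
oddCover-cover n _ _ (inner i i′ (zero , e)) with isEven (toℕ i) in ei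
... | false = inj₁ (oddInner-odd (toℕ i) ei)
... | true  = inj₂ (oddInner-odd (toℕ i′)
                     (trans (unwrapped-parity (toℕ i) (toℕ i′) 3 e)
                            (trans (isEven-+-odd {3} (toℕ i) refl) (cong not ei))))
oddCover-cover n _ _ (inner i i′ (suc q , e)) =
  inj₂ (oddInner-small (toℕ i′) (wrapped-target (toℕ i) (toℕ i′) 3 q (toℕ<n i) e))

-- Indices 0, 1, 2 contribute 2 + 1 + 2 vertices, every later spoke exactly one.
oddCover-size : ∀ j → size (oddCover {7 + 2 * j}) ≡ 7 + 2 * j + 2
oddCover-size j =
  trans (size-pairCount (oddCover {7 + 2 * j}))
        (trans (cong (5 +_) (pairCount-complement (4 + 2 * j) (λ i → isEven (suc (toℕ i)))))
               (+-comm 2 (7 + 2 * j)))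

vertexCoverNumber-odd : ∀ j → VertexCoverNumber (7 + 2 * j) 3 (7 + 2 * j + 2)
vertexCoverNumber-odd j =
  (oddCover , oddCover-cover (7 + 2 * j) , oddCover-size j) , OddLowerBound.lower-bound j

odd-as-7+2j : ∀ m → 7 ≤ 2 * m + 1 → ∃[ j ] 2 * m + 1 ≡ 7 + 2 * j
odd-as-7+2j zero                   (s≤s ())
odd-as-7+2j (suc zero)             (s≤s (s≤s (s≤s ())))
odd-as-7+2j (suc (suc zero))       (s≤s (s≤s (s≤s (s≤s (s≤s ())))))
odd-as-7+2j (suc (suc (suc j))) _ = j , shift j
  where
    shift : ∀ j → 2 * (3 + j) + 1 ≡ 7 + 2 * j
    shift = solve-∀

proposition20 : (n : ℕ) → 7 ≤ n →
    (∀ m → n ≡ 2 * m → VertexCoverNumber n 3 n)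
    × (∀ m → n ≡ 2 * m + 1 → VertexCoverNumber n 3 (n + 2))
proposition20 n 7≤n = even-case , odd-case
  where
    even-case : ∀ m → n ≡ 2 * m → VertexCoverNumber n 3 n
    even-case m n≡2m =
      vertexCoverNumber-even n 3 (subst (λ x → isEven x ≡ true) (sym n≡2m) (isEven-double m)) refl

    odd-case : ∀ m → n ≡ 2 * m + 1 → VertexCoverNumber n 3 (n + 2)
    odd-case m n≡2m+1 with odd-as-7+2j m (subst (7 ≤_) n≡2m+1 7≤n)
    ... | j , 2m+1≡7+2j =
      subst (λ x → VertexCoverNumber x 3 (x + 2)) (sym (trans n≡2m+1 2m+1≡7+2j)) (vertexCoverNumber-odd j)
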